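{- There is a constant $c > 0$ such that for every $n \ge 4$, the complete graph $K_n$ satisfies $\mathrm{str}_{\mathrm{gap}}(K_n) \ge c\, n^{6/5}$; that is, $\mathrm{str}_{\mathrm{gap}}(K_n) \in \Omega(n^{6/5})$.
   Context: For $k \in \mathbb{N}$ and $[k] = \{1, \ldots, k\}$, a gap-$[k]$-vertex-labelling of a connected graph $G$ is a pair $(\pi, c_\pi)$ where $\pi : V(G) \to [k]$ and $c_\pi : V(G) \to \{0, 1, \ldots, k\}$ is a proper vertex colouring of $G$ such that for every $v \in V(G)$: if $d(v) \ge 2$ then $c_\pi(v) = \max_{u \in N(v)} \pi(u) - \min_{u \in N(v)} \pi(u)$, and if $d(v) = 1$ then $c_\pi(v) = \pi(u)$ where $u$ is the unique neighbour of $v$. A connected graph is gap-vertex-labelable if it admits a gap-$[k]$-vertex-labelling for some $k$; a graph is gap-vertex-labelable iff all its connected components are. For a graph $G$ and $l \ge 0$, $G^{ -l}$ is the family of graphs obtained from $G$ by removing $l$ edges. For a graph $G$ that is not gap-vertex-labelable (e.g. $K_n$ with $n \ge 4$), its gap-strength $\mathrm{str}_{\mathrm{gap}}(G)$ is the least $l$ such that some graph in $G^{ -l}$ is gap-vertex-labelable. -}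

module Defs where

open import Data.Bool using (Bool; true; false; T; not)
open import Data.Nat using (ℕ; zero; suc; _+_; _*_; _∸_; _^_; _≤_; _<_; _⊔_; _⊓_; _<ᵇ_)
open import Data.Fin using (Fin; toℕ)
open import Data.Fin.Properties using (_≟_)
open import Data.List using (List; []; _∷_; map; filterᵇ; length; foldr; concatMap; allFin)
open import Data.Product using (Σ; _×_; _,_; ∃)
open import Relation.Nullary using (¬_; does)
open import Relation.Binary.PropositionalEquality using (_≡_; _≢_)

record SimpleGraph (n : ℕ) : Set where
  field
    adj   : Fin n → Fin n → Bool
    sym   : ∀ u v → adj u v ≡ adj v u
    irrefl : ∀ v → adj v v ≡ false
open SimpleGraph public

K : (n : ℕ) → SimpleGraph n
K n = record
  { adj = λ u v → not (does (u ≟ v))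
  ; sym = symK
  ; irrefl = irrK
  }
  where
  symK : ∀ u v → not (does (u ≟ v)) ≡ not (does (v ≟ u))
  symK u v with u ≟ v | v ≟ u
  ... | Relation.Nullary.yes _ | Relation.Nullary.yes _ = Relation.Binary.PropositionalEquality.refl
  ... | Relation.Nullary.no _  | Relation.Nullary.no _  = Relation.Binary.PropositionalEquality.refl
  ... | Relation.Nullary.yes p | Relation.Nullary.no q  = Data.Empty.⊥-elim (q (Relation.Binary.PropositionalEquality.sym p))
    where import Data.Empty
  ... | Relation.Nullary.no q  | Relation.Nullary.yes p = Data.Empty.⊥-elim (q (Relation.Binary.PropositionalEquality.sym p))
    where import Data.Empty
  irrK : ∀ v → not (does (v ≟ v)) ≡ false
  irrK v with v ≟ v
  ... | Relation.Nullary.yes _ = Relation.Binary.PropositionalEquality.refl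
  ... | Relation.Nullary.no q  = Data.Empty.⊥-elim (q Relation.Binary.PropositionalEquality.refl)
    where import Data.Empty

edgeCount : ∀ {n} → SimpleGraph n → ℕ
edgeCount {n} G =
  length (concatMap (λ u → filterᵇ (λ v → (toℕ u <ᵇ toℕ v) Data.Bool.∧ adj G u v) (allFin n)) (allFin n))
  where import Data.Bool

-- H ∈ G^{-l}: H is a spanning subgraph of G obtained by removing exactly l edges.
Removes : ∀ {n} → SimpleGraph n → ℕ → SimpleGraph n → Set
Removes {n} G l H =
  (∀ u v → T (adj H u v) → T (adj G u v)) × (edgeCount H + l ≡ edgeCount G)

nbrs : ∀ {n} → SimpleGraph n → Fin n → List (Fin n)
nbrs {n} G v = filterᵇ (adj G v) (allFin n)

deg : ∀ {n} → SimpleGraph n → Fin n → ℕ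
deg G v = length (nbrs G v)

-- max / min of a list of naturals (min only meaningful on nonempty lists).
maxL : List ℕ → ℕ
maxL = foldr _⊔_ 0

minL : List ℕ → ℕ
minL [] = 0
minL (x ∷ xs) = foldr _⊓_ x xs

IsGapLabelling : ∀ {n} → SimpleGraph n → ℕ → (Fin n → ℕ) → (Fin n → ℕ) → Set
IsGapLabelling {n} G k π c =
  (∀ v → 1 ≤ π v × π v ≤ k)
  × (∀ v → c v ≤ k)
  × (∀ u v → T (adj G u v) → c u ≢ c v)
  × (∀ v → 2 ≤ deg G v →
       c v ≡ maxL (map π (nbrs G v)) ∸ minL (map π (nbrs G v)))
  × (∀ v u → nbrs G v ≡ u ∷ [] → c v ≡ π u)

GapLabelable : ∀ {n} → SimpleGraph n → Set
GapLabelable {n} G = ∃ λ k → Σ (Fin n → ℕ) λ π → Σ (Fin n → ℕ) λ c → IsGapLabelling G k π c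

LabelableAfterRemoving : ∀ {n} → SimpleGraph n → ℕ → Set
LabelableAfterRemoving {n} G l = Σ (SimpleGraph n) λ H → Removes G l H × GapLabelable H

IsGapStrength : ∀ {n} → SimpleGraph n → ℕ → Set
IsGapStrength G s = LabelableAfterRemoving G s × (∀ l → l < s → ¬ LabelableAfterRemoving G l)

-- Let H be K_n with s edges removed, carrying a gap labelling (π, c), and fix
-- a threshold D.  A vertex v missing at most D edges has at least two
-- neighbours, so c v = max π − min π over N(v); as N(v) omits at most D other
-- vertices, both extremes are attained among the D + 2 vertices of largest
-- (resp. smallest) label, ties broken by index.  So the colours of these low
-- vertices take at most (D + 2)² values, and a colour class of low vertices,
-- being independent in H, has at most D + 1 members.  Every other vertex misses
-- more than D edges, so there are at most 2s/(D + 1) of them.  Choosing D with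
-- 2(D + 2)³ ≤ n < 2(D + 3)³ leaves at least n/2 high vertices, whence
-- n(D + 1) ≤ 4s and n ≤ 54(D + 1)³, i.e. n⁶ ≤ 55296 s⁵.  For s = 0 the same
-- reasoning with the global extremes gives all but two vertices of K_n one
-- colour, impossible for n ≥ 4; small n are absorbed into the constant.

module Submission where

open import Defs
open import Data.Nat using (ℕ; zero; suc; _+_; _*_; _∸_; _^_; _≤_; _<_; _≤ᵇ_; _<ᵇ_; _≡ᵇ_; _⊓_; z≤n; s≤s; NonZero)
open import Data.Nat.Properties hiding (_≟_)
open import Data.Nat.Tactic.RingSolver using (solve-∀)
open import Algebra.Properties.CommutativeSemigroup +-commutativeSemigroup using (interchange)
open import Data.Product using (Σ; _×_; ∃-syntax; _,_; proj₁; proj₂)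
open import Data.Sum using (_⊎_; inj₁; inj₂; map₁)
open import Data.Bool using (Bool; true; false; T; not; _∧_)
open import Data.Empty using (⊥-elim)
open import Data.Fin using (Fin; zero; suc; toℕ)
open import Data.Fin.Properties using (_≟_; toℕ<n; toℕ-injective)
open import Data.List using (List; []; _∷_; map; filterᵇ; length; foldr; allFin; concatMap; cartesianProductWith)
open import Data.List.Properties using (length-++; length-map; length-tabulate; map-tabulate)
open import Data.List.Relation.Unary.Any using (here; there)
import Data.List.Relation.Unary.All as All
open import Data.List.Membership.Propositional using (_∈_)
open import Data.List.Membership.Propositional.Properties using (∈-allFin; ∈-filter⁺; ∈-filter⁻; ∈-cartesianProductWith⁺)
open import Data.List.Extrema.Nat using (argmax; argmin; argmax-sel; argmin-sel; f[⊥]≤f[argmax]; f[xs]≤f[argmax]; f[argmin]≤f[⊤]; f[argmin]≤f[xs])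
open import Function using (_∘_; id)
open import Function.Definitions using (Injective)
open import Relation.Binary.Definitions using (tri<; tri≈; tri>)
open import Relation.Nullary using (¬_; Dec; does; yes; no; T?)
open import Relation.Nullary.Decidable using (dec-true; dec-false)
import Relation.Binary.PropositionalEquality as ≡
open ≡ using (_≡_; _≢_; refl; cong; cong₂; subst; module ≡-Reasoning)

-- Indicator sums over lists

𝟙 : Bool → ℕ
𝟙 true = 1
𝟙 false = 0

T⇒0<𝟙 : ∀ {b} → T b → 0 < 𝟙 b
T⇒0<𝟙 {true} _ = s≤s z≤n

𝟙-≤-+ : ∀ {b c d} → (T b → T c ⊎ T d) → 𝟙 b ≤ 𝟙 c + 𝟙 d
𝟙-≤-+ {false} _ = z≤n
𝟙-≤-+ {true} {true} _ = s≤s z≤n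
𝟙-≤-+ {true} {false} {true} _ = s≤s z≤n
𝟙-≤-+ {true} {false} {false} cover with cover _
... | inj₁ ()
... | inj₂ ()

<ᵇ-true : ∀ {m n} → m < n → (m <ᵇ n) ≡ true
<ᵇ-true {m} {n} = dec-true (m <? n)

<ᵇ-false : ∀ {m n} → ¬ m < n → (m <ᵇ n) ≡ false
<ᵇ-false {m} {n} = dec-false (m <? n)

∑ : {A : Set} → List A → (A → ℕ) → ℕ
∑ [] f = 0
∑ (x ∷ xs) f = f x + ∑ xs f

syntax ∑ xs (λ x → e) = ∑[ x ∈ xs ] e

count : {A : Set} → (A → Bool) → List A → ℕ
count p xs = ∑[ x ∈ xs ] 𝟙 (p x)

module _ {A : Set} where

  ∑-zero : (xs : List A) → ∑[ x ∈ xs ] 0 ≡ 0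
  ∑-zero [] = refl
  ∑-zero (_ ∷ xs) = ∑-zero xs

  ∑-cong : (xs : List A) {f g : A → ℕ} → (∀ x → f x ≡ g x) → ∑ xs f ≡ ∑ xs g
  ∑-cong [] _ = refl
  ∑-cong (x ∷ xs) f≗g = cong₂ _+_ (f≗g x) (∑-cong xs f≗g)

  ∑-mono : (xs : List A) {f g : A → ℕ} → (∀ {x} → x ∈ xs → f x ≤ g x) → ∑ xs f ≤ ∑ xs g
  ∑-mono [] _ = z≤n
  ∑-mono (x ∷ xs) f≤g = +-mono-≤ (f≤g (here refl)) (∑-mono xs (f≤g ∘ there))

  ∑-+ : (xs : List A) (f g : A → ℕ) → ∑[ x ∈ xs ] (f x + g x) ≡ ∑ xs f + ∑ xs g
  ∑-+ [] f g = refl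
  ∑-+ (x ∷ xs) f g = ≡.trans (cong (f x + g x +_) (∑-+ xs f g)) (interchange (f x) (g x) (∑ xs f) (∑ xs g))

  ∑-≤-length* : (xs : List A) {f : A → ℕ} {t : ℕ} → (∀ {x} → x ∈ xs → f x ≤ t) → ∑ xs f ≤ length xs * t
  ∑-≤-length* [] _ = z≤n
  ∑-≤-length* (x ∷ xs) f≤t = +-mono-≤ (f≤t (here refl)) (∑-≤-length* xs (f≤t ∘ there))

  ∑-1 : (xs : List A) → ∑[ x ∈ xs ] 1 ≡ length xs
  ∑-1 [] = refl
  ∑-1 (_ ∷ xs) = cong suc (∑-1 xs)

  ∑-map : {B : Set} (g : B → A) (xs : List B) (f : A → ℕ) → ∑ (map g xs) f ≡ ∑[ x ∈ xs ] f (g x)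
  ∑-map g [] f = refl
  ∑-map g (x ∷ xs) f = cong (f (g x) +_) (∑-map g xs f)

  ∑≡0⇒≡0 : (xs : List A) (f : A → ℕ) → ∑ xs f ≡ 0 → ∀ {x} → x ∈ xs → f x ≡ 0
  ∑≡0⇒≡0 (y ∷ xs) f ∑≡0 (here refl) = m+n≡0⇒m≡0 (f y) ∑≡0
  ∑≡0⇒≡0 (y ∷ xs) f ∑≡0 (there x∈) = ∑≡0⇒≡0 xs f (m+n≡0⇒n≡0 (f y) ∑≡0) x∈

  length-filterᵇ : (p : A → Bool) (xs : List A) → length (filterᵇ p xs) ≡ count p xs
  length-filterᵇ p [] = refl
  length-filterᵇ p (x ∷ xs) with p x
  ... | true = cong suc (length-filterᵇ p xs)
  ... | false = length-filterᵇ p xs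

  count-filterᵇ-≤ : (p q : A → Bool) (xs : List A) → count p (filterᵇ q xs) ≤ count p xs
  count-filterᵇ-≤ p q [] = z≤n
  count-filterᵇ-≤ p q (x ∷ xs) with q x
  ... | true = +-monoʳ-≤ (𝟙 (p x)) (count-filterᵇ-≤ p q xs)
  ... | false = ≤-trans (count-filterᵇ-≤ p q xs) (m≤n+m _ (𝟙 (p x)))

  count-witness : (p : A → Bool) (xs : List A) → 0 < count p xs → ∃[ x ] x ∈ xs × T (p x)
  count-witness p (x ∷ xs) pos with p x in px
  ... | true = x , here refl , subst T (≡.sym px) _
  ... | false with count-witness p xs pos
  ...   | y , y∈ , py = y , there y∈ , py

  length≡count+count-not : (p : A → Bool) (xs : List A) → length xs ≡ count p xs + count (not ∘ p) xs
  length≡count+count-not p [] = refl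
  length≡count+count-not p (x ∷ xs) with p x
  ... | true = cong suc (length≡count+count-not p xs)
  ... | false = ≡.trans (cong suc (length≡count+count-not p xs)) (≡.sym (+-suc _ _))

  markov : (f : A → ℕ) (t : ℕ) (xs : List A) → count (λ x → not (f x ≤ᵇ t)) xs * suc t ≤ ∑ xs f
  markov f t [] = z≤n
  markov f t (x ∷ xs) = begin
    (𝟙 (not (f x ≤ᵇ t)) + count (λ x → not (f x ≤ᵇ t)) xs) * suc t
      ≡⟨ *-distribʳ-+ (suc t) (𝟙 (not (f x ≤ᵇ t))) _ ⟩
    𝟙 (not (f x ≤ᵇ t)) * suc t + count (λ x → not (f x ≤ᵇ t)) xs * suc t
      ≤⟨ +-mono-≤ exceeds (markov f t xs) ⟩
    f x + ∑ xs f ∎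
    where
    open ≤-Reasoning
    exceeds : 𝟙 (not (f x ≤ᵇ t)) * suc t ≤ f x
    exceeds with f x ≤? t
    ... | yes fx≤t rewrite dec-true (f x ≤? t) fx≤t = z≤n
    ... | no fx≰t rewrite dec-false (f x ≤? t) fx≰t = ≤-trans (≤-reflexive (*-identityˡ (suc t))) (≰⇒> fx≰t)

∑-swap : {A B : Set} (xs : List A) (ys : List B) (f : A → B → ℕ) →
  ∑[ x ∈ xs ] ∑[ y ∈ ys ] f x y ≡ ∑[ y ∈ ys ] ∑[ x ∈ xs ] f x y
∑-swap [] ys f = ≡.sym (∑-zero ys)
∑-swap (x ∷ xs) ys f = ≡.trans (cong (∑ ys (f x) +_) (∑-swap xs ys f)) (≡.sym (∑-+ ys (f x) _))

length-concatMap : {A B : Set} (g : A → List B) (xs : List A) → length (concatMap g xs) ≡ ∑[ x ∈ xs ] length (g x)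
length-concatMap g [] = refl
length-concatMap g (x ∷ xs) = ≡.trans (length-++ (g x)) (cong (length (g x) +_) (length-concatMap g xs))

length-cartesianProductWith : {A B C : Set} (f : A → B → C) (xs : List A) (ys : List B) →
  length (cartesianProductWith f xs ys) ≡ length xs * length ys
length-cartesianProductWith f [] ys = refl
length-cartesianProductWith f (x ∷ xs) ys =
  ≡.trans (length-++ (map (f x) ys)) (cong₂ _+_ (length-map (f x) ys) (length-cartesianProductWith f xs ys))

∈⇒0<count : ∀ {y ys} → y ∈ ys → 0 < count (y ≡ᵇ_) ys
∈⇒0<count {y} (here refl) = ≤-trans (T⇒0<𝟙 (≡⇒≡ᵇ y y refl)) (m≤m+n _ _)
∈⇒0<count (there y∈) = ≤-trans (∈⇒0<count y∈) (m≤n+m _ _)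

length≤-by-fibres : {A : Set} (f : A → ℕ) (xs : List A) (ys : List ℕ) {m : ℕ} →
  (∀ {x} → x ∈ xs → f x ∈ ys) →
  (∀ {x} → x ∈ xs → count (λ x′ → f x′ ≡ᵇ f x) xs ≤ m) →
  length xs ≤ length ys * m
length≤-by-fibres f xs ys {m} f∈ys fibre = begin
  length xs                               ≡⟨ ∑-1 xs ⟨
  ∑[ x ∈ xs ] 1                           ≤⟨ ∑-mono xs (∈⇒0<count ∘ f∈ys) ⟩
  ∑[ x ∈ xs ] count (f x ≡ᵇ_) ys          ≡⟨ ∑-swap xs ys _ ⟩
  ∑[ y ∈ ys ] count (λ x → f x ≡ᵇ y) xs   ≤⟨ ∑-≤-length* ys (λ {y} _ → fibre-bound y) ⟩
  length ys * m                           ∎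
  where
  open ≤-Reasoning
  fibre-bound : ∀ y → count (λ x → f x ≡ᵇ y) xs ≤ m
  fibre-bound y with 0 <? count (λ x → f x ≡ᵇ y) xs
  ... | no empty = ≤-trans (≮⇒≥ empty) z≤n
  ... | yes nonempty with count-witness _ xs nonempty
  ...   | x , x∈ , fx≡y = subst (λ z → count (λ x′ → f x′ ≡ᵇ z) xs ≤ m) (≡ᵇ⇒≡ (f x) y fx≡y) (fibre x∈)

module _ {A : Set} (p : A → Bool) where

  ∈-filterᵇ⁺ : ∀ {x xs} → x ∈ xs → T (p x) → x ∈ filterᵇ p xs
  ∈-filterᵇ⁺ = ∈-filter⁺ (T? ∘ p)

  ∈-filterᵇ⁻ : ∀ {x xs} → x ∈ filterᵇ p xs → x ∈ xs × T (p x)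
  ∈-filterᵇ⁻ = ∈-filter⁻ (T? ∘ p)

module _ {A : Set} (κ : A → ℕ) where

  maximal-∈ : (xs : List A) → 0 < length xs → ∃[ a ] a ∈ xs × (∀ {w} → w ∈ xs → κ w ≤ κ a)
  maximal-∈ (x ∷ xs) _ = argmax κ x xs , ∈-argmax , maximal
    where
    ∈-argmax : argmax κ x xs ∈ x ∷ xs
    ∈-argmax with argmax-sel κ x xs
    ... | inj₁ ≡x = subst (_∈ x ∷ xs) (≡.sym ≡x) (here refl)
    ... | inj₂ ∈xs = there ∈xs
    maximal : ∀ {w} → w ∈ x ∷ xs → κ w ≤ κ (argmax κ x xs)
    maximal (here refl) = f[⊥]≤f[argmax] {f = κ} x xs
    maximal (there w∈) = All.lookup (f[xs]≤f[argmax] {f = κ} x xs) w∈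

  minimal-∈ : (xs : List A) → 0 < length xs → ∃[ a ] a ∈ xs × (∀ {w} → w ∈ xs → κ a ≤ κ w)
  minimal-∈ (x ∷ xs) _ = argmin κ x xs , ∈-argmin , minimal
    where
    ∈-argmin : argmin κ x xs ∈ x ∷ xs
    ∈-argmin with argmin-sel κ x xs
    ... | inj₁ ≡x = subst (_∈ x ∷ xs) (≡.sym ≡x) (here refl)
    ... | inj₂ ∈xs = there ∈xs
    minimal : ∀ {w} → w ∈ x ∷ xs → κ (argmin κ x xs) ≤ κ w
    minimal (here refl) = f[argmin]≤f[⊤] {f = κ} x xs
    minimal (there w∈) = All.lookup (f[argmin]≤f[xs] {f = κ} x xs) w∈

module _ {A : Set} (g : A → ℕ) where

  maxL-map-≡ : ∀ {xs a} → a ∈ xs → (∀ {w} → w ∈ xs → g w ≤ g a) → maxL (map g xs) ≡ g a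
  maxL-map-≡ a∈ top = ≤-antisym (maxL≤ top) (≤maxL a∈)
    where
    ≤maxL : ∀ {xs a} → a ∈ xs → g a ≤ maxL (map g xs)
    ≤maxL {y ∷ _} (here refl) = m≤m⊔n (g y) _
    ≤maxL {y ∷ _} (there a∈) = ≤-trans (≤maxL a∈) (m≤n⊔m (g y) _)
    maxL≤ : ∀ {xs t} → (∀ {w} → w ∈ xs → g w ≤ t) → maxL (map g xs) ≤ t
    maxL≤ {[]} _ = z≤n
    maxL≤ {y ∷ _} ≤t = ⊔-lub (≤t (here refl)) (maxL≤ (≤t ∘ there))

  minL-map-≡ : ∀ {xs b} → b ∈ xs → (∀ {w} → w ∈ xs → g b ≤ g w) → minL (map g xs) ≡ g b
  minL-map-≡ {y ∷ ys} b∈ bottom = ≤-antisym (minL≤ b∈) (≤foldr (bottom (here refl)) (bottom ∘ there))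
    where
    foldr≤base : ∀ z ys → foldr _⊓_ z (map g ys) ≤ z
    foldr≤base z [] = ≤-refl
    foldr≤base z (w ∷ ws) = m≤n⇒o⊓m≤n (g w) (foldr≤base z ws)
    foldr≤ : ∀ z {ys w} → w ∈ ys → foldr _⊓_ z (map g ys) ≤ g w
    foldr≤ z {w ∷ _} (here refl) = m⊓n≤m (g w) _
    foldr≤ z {w ∷ _} (there w∈) = m≤n⇒o⊓m≤n (g w) (foldr≤ z w∈)
    ≤foldr : ∀ {z ys t} → t ≤ z → (∀ {w} → w ∈ ys → t ≤ g w) → t ≤ foldr _⊓_ z (map g ys)
    ≤foldr {ys = []} t≤z _ = t≤z
    ≤foldr {ys = w ∷ _} t≤z t≤ = ⊓-glb (t≤ (here refl)) (≤foldr t≤z (t≤ ∘ there))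
    minL≤ : ∀ {b} → b ∈ y ∷ ys → minL (map g (y ∷ ys)) ≤ g b
    minL≤ (here refl) = foldr≤base (g y) ys
    minL≤ (there b∈) = foldr≤ (g y) b∈

∑-allFin-suc : ∀ {n} (f : Fin (suc n) → ℕ) → ∑ (allFin (suc n)) f ≡ f zero + ∑[ i ∈ allFin n ] f (suc i)
∑-allFin-suc {n} f = cong (f zero +_) (≡.trans (cong (λ xs → ∑ xs f) (≡.sym (map-tabulate id suc))) (∑-map suc (allFin n) f))

∑-allFin-1 : ∀ n → ∑[ v ∈ allFin n ] 1 ≡ n
∑-allFin-1 n = ≡.trans (∑-1 (allFin n)) (length-tabulate id)

count-≟-allFin : ∀ {n} (v : Fin n) → count (λ u → does (v ≟ u)) (allFin n) ≡ 1
count-≟-allFin {suc n} zero = ≡.trans (∑-allFin-suc {n} (λ u → 𝟙 (does (zero ≟ u)))) (cong suc (∑-zero (allFin n)))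
count-≟-allFin {suc n} (suc v) = ≡.trans (∑-allFin-suc {n} (λ u → 𝟙 (does (suc v ≟ u)))) (count-≟-allFin v)

count-≤-suc : ∀ {n} (p q : Fin n → Bool) (v : Fin n) → (∀ w → T (p w) → v ≡ w ⊎ T (q w)) →
  count p (allFin n) ≤ suc (count q (allFin n))
count-≤-suc {n} p q v cover = begin
  count p (allFin n)
    ≤⟨ ∑-mono (allFin n) (λ {w} _ → 𝟙-≤-+ (map₁ ≡⇒T-≟ ∘ cover w)) ⟩
  ∑[ w ∈ allFin n ] (𝟙 (does (v ≟ w)) + 𝟙 (q w))
    ≡⟨ ∑-+ (allFin n) _ _ ⟩
  count (λ w → does (v ≟ w)) (allFin n) + count q (allFin n)
    ≡⟨ cong (_+ count q (allFin n)) (count-≟-allFin v) ⟩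
  suc (count q (allFin n)) ∎
  where
  open ≤-Reasoning
  ≡⇒T-≟ : ∀ {w} → v ≡ w → T (does (v ≟ w))
  ≡⇒T-≟ refl = subst T (≡.sym (dec-true (v ≟ v) refl)) _

-- Degrees in a graph and its complement

complement : ∀ {n} → SimpleGraph n → SimpleGraph n
complement {n} G = record
  { adj = λ u v → adj (K n) u v ∧ not (adj G u v)
  ; sym = λ u v → cong₂ _∧_ (SimpleGraph.sym (K n) u v) (cong not (SimpleGraph.sym G u v))
  ; irrefl = λ v → cong (_∧ not (adj G v v)) (irrefl (K n) v)
  }

module _ {n : ℕ} (G : SimpleGraph n) where

  deg≡count : ∀ v → deg G v ≡ count (adj G v) (allFin n)
  deg≡count v = length-filterᵇ (adj G v) (allFin n)

  edgeCount≡∑ : edgeCount G ≡ ∑[ u ∈ allFin n ] count (λ v → (toℕ u <ᵇ toℕ v) ∧ adj G u v) (allFin n)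
  edgeCount≡∑ = ≡.trans (length-concatMap _ (allFin n)) (∑-cong (allFin n) (λ u → length-filterᵇ _ (allFin n)))

  adj-split : ∀ v u → 𝟙 (adj G v u) ≡ 𝟙 ((toℕ v <ᵇ toℕ u) ∧ adj G v u) + 𝟙 ((toℕ u <ᵇ toℕ v) ∧ adj G u v)
  adj-split v u with <-cmp (toℕ v) (toℕ u)
  ... | tri< v<u _ u≮v rewrite <ᵇ-true v<u | <ᵇ-false u≮v = ≡.sym (+-identityʳ _)
  ... | tri> v≮u _ u<v rewrite <ᵇ-false v≮u | <ᵇ-true u<v | SimpleGraph.sym G v u = refl
  ... | tri≈ _ v≡u _ rewrite toℕ-injective v≡u | <ᵇ-false (n≮n (toℕ u)) | irrefl G u = refl

  handshake : ∑[ v ∈ allFin n ] deg G v ≡ edgeCount G + edgeCount G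
  handshake = begin
    ∑[ v ∈ allFin n ] deg G v
      ≡⟨ ∑-cong (allFin n) (λ v → ≡.trans (deg≡count v) (∑-cong (allFin n) (adj-split v))) ⟩
    ∑[ v ∈ allFin n ] ∑[ u ∈ allFin n ] (forward v u + backward v u)
      ≡⟨ ∑-cong (allFin n) (λ v → ∑-+ (allFin n) (forward v) (backward v)) ⟩
    ∑[ v ∈ allFin n ] (∑ (allFin n) (forward v) + ∑ (allFin n) (backward v))
      ≡⟨ ∑-+ (allFin n) _ _ ⟩
    ∑[ v ∈ allFin n ] ∑ (allFin n) (forward v) + ∑[ v ∈ allFin n ] ∑ (allFin n) (backward v)
      ≡⟨ cong₂ _+_ (≡.sym edgeCount≡∑) (≡.trans (∑-swap (allFin n) (allFin n) backward) (≡.sym edgeCount≡∑)) ⟩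
    edgeCount G + edgeCount G ∎
    where
    open ≡-Reasoning
    forward backward : Fin n → Fin n → ℕ
    forward v u = 𝟙 ((toℕ v <ᵇ toℕ u) ∧ adj G v u)
    backward v u = 𝟙 ((toℕ u <ᵇ toℕ v) ∧ adj G u v)

module _ {n : ℕ} (G : SimpleGraph n) where

  edge-split : ∀ u v (b : Bool) → 𝟙 (b ∧ adj (K n) u v) ≡ 𝟙 (b ∧ adj G u v) + 𝟙 (b ∧ adj (complement G) u v)
  edge-split u v false = refl
  edge-split u v true with u ≟ v
  ... | yes refl rewrite irrefl G u = refl
  ... | no _ with adj G u v
  ...   | true = refl
  ...   | false = refl

  edgeCount-K : edgeCount (K n) ≡ edgeCount G + edgeCount (complement G)
  edgeCount-K = begin
    edgeCount (K n)
      ≡⟨ edgeCount≡∑ (K n) ⟩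
    ∑[ u ∈ allFin n ] ∑[ v ∈ allFin n ] 𝟙 ((toℕ u <ᵇ toℕ v) ∧ adj (K n) u v)
      ≡⟨ ∑-cong (allFin n) (λ u → ≡.trans (∑-cong (allFin n) (λ v → edge-split u v _)) (∑-+ (allFin n) _ _)) ⟩
    ∑[ u ∈ allFin n ] (∑ (allFin n) (in-G u) + ∑ (allFin n) (in-Gᶜ u))
      ≡⟨ ∑-+ (allFin n) _ _ ⟩
    ∑[ u ∈ allFin n ] ∑ (allFin n) (in-G u) + ∑[ u ∈ allFin n ] ∑ (allFin n) (in-Gᶜ u)
      ≡⟨ cong₂ _+_ (≡.sym (edgeCount≡∑ G)) (≡.sym (edgeCount≡∑ (complement G))) ⟩
    edgeCount G + edgeCount (complement G) ∎
    where
    open ≡-Reasoning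
    in-G in-Gᶜ : Fin n → Fin n → ℕ
    in-G u v = 𝟙 ((toℕ u <ᵇ toℕ v) ∧ adj G u v)
    in-Gᶜ u v = 𝟙 ((toℕ u <ᵇ toℕ v) ∧ adj (complement G) u v)

  partition : ∀ v u → 𝟙 (does (v ≟ u)) + (𝟙 (adj G v u) + 𝟙 (adj (complement G) v u)) ≡ 1
  partition v u with v ≟ u
  ... | yes refl rewrite irrefl G v = refl
  ... | no _ with adj G v u
  ...   | true = refl
  ...   | false = refl

  suc-deg+deg-complement : ∀ v → suc (deg G v + deg (complement G) v) ≡ n
  suc-deg+deg-complement v = begin
    suc (deg G v + deg (complement G) v)
      ≡⟨ cong₂ (λ a b → a + (b + deg (complement G) v)) (≡.sym (count-≟-allFin v)) (deg≡count G v) ⟩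
    count (λ u → does (v ≟ u)) (allFin n) + (count (adj G v) (allFin n) + deg (complement G) v)
      ≡⟨ cong (λ b → count (λ u → does (v ≟ u)) (allFin n) + (count (adj G v) (allFin n) + b)) (deg≡count (complement G) v) ⟩
    count (λ u → does (v ≟ u)) (allFin n) + (count (adj G v) (allFin n) + count (adj (complement G) v) (allFin n))
      ≡⟨ cong (count (λ u → does (v ≟ u)) (allFin n) +_) (∑-+ (allFin n) _ _) ⟨
    count (λ u → does (v ≟ u)) (allFin n) + ∑[ u ∈ allFin n ] (𝟙 (adj G v u) + 𝟙 (adj (complement G) v u))
      ≡⟨ ∑-+ (allFin n) _ _ ⟨
    ∑[ u ∈ allFin n ] (𝟙 (does (v ≟ u)) + (𝟙 (adj G v u) + 𝟙 (adj (complement G) v u)))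
      ≡⟨ ∑-cong (allFin n) (partition v) ⟩
    ∑[ u ∈ allFin n ] 1
      ≡⟨ ∑-allFin-1 n ⟩
    n ∎
    where open ≡-Reasoning

  2≤deg : ∀ {v D} → 3 + D ≤ n → deg (complement G) v ≤ D → 2 ≤ deg G v
  2≤deg {v} {D} 3+D≤n codeg≤D = +-cancelʳ-≤ D 2 (deg G v) (begin
    2 + D                             ≤⟨ ≤-pred (≤-trans 3+D≤n (≤-reflexive (≡.sym (suc-deg+deg-complement v)))) ⟩
    deg G v + deg (complement G) v    ≤⟨ +-monoʳ-≤ (deg G v) codeg≤D ⟩
    deg G v + D                       ∎)
    where open ≤-Reasoning

  ∑-deg-complement : ∀ {s} → Removes (K n) s G → ∑[ v ∈ allFin n ] deg (complement G) v ≡ s + s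
  ∑-deg-complement {s} (_ , count+s≡count) = ≡.trans (handshake (complement G)) (cong₂ _+_ s≡ s≡)
    where
    s≡ : edgeCount (complement G) ≡ s
    s≡ = +-cancelˡ-≡ (edgeCount G) _ _ (≡.trans (≡.sym edgeCount-K) (≡.sym count+s≡count))

  vertex-or-complement : ∀ v w → ¬ T (adj G v w) → v ≡ w ⊎ T (adj (complement G) v w)
  vertex-or-complement v w ¬vw with v ≟ w | adj G v w
  ... | yes v≡w | _ = inj₁ v≡w
  ... | no _ | false = inj₂ _
  ... | no _ | true = ⊥-elim (¬vw _)

  count≤suc-codegree : (p : Fin n → Bool) (v : Fin n) → (∀ w → T (p w) → ¬ T (adj G v w)) →
    count p (allFin n) ≤ suc (deg (complement G) v)
  count≤suc-codegree p v non-neighbours = begin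
    count p (allFin n)                               ≤⟨ count-≤-suc p (adj (complement G) v) v cover ⟩
    suc (count (adj (complement G) v) (allFin n))    ≡⟨ cong suc (deg≡count (complement G) v) ⟨
    suc (deg (complement G) v)                       ∎
    where
    open ≤-Reasoning
    cover : ∀ w → T (p w) → v ≡ w ⊎ T (adj (complement G) v w)
    cover w pw = vertex-or-complement v w (non-neighbours w pw)

  codegree≡0⇒adjacent : ∀ {v u} → deg (complement G) v ≡ 0 → v ≢ u → T (adj G v u)
  codegree≡0⇒adjacent {v} {u} codeg≡0 v≢u with adj G v u in vu
  ... | true = _
  ... | false with vertex-or-complement v u (subst T vu)
  ...   | inj₁ v≡u = ⊥-elim (v≢u v≡u)
  ...   | inj₂ vu∈Gᶜ = ⊥-elim (<⇒≢ (T⇒0<𝟙 vu∈Gᶜ) (≡.sym (∑≡0⇒≡0 (allFin n) _ no-codegree (∈-allFin u))))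
    where
    no-codegree : count (adj (complement G) v) (allFin n) ≡ 0
    no-codegree = ≡.trans (≡.sym (deg≡count (complement G) v)) codeg≡0

-- Ranks with respect to an injective key

tiebreak : ∀ {n} → (Fin n → ℕ) → Fin n → ℕ
tiebreak {n} f w = f w * n + toℕ w

module _ {n : ℕ} (f : Fin n → ℕ) where

  tiebreak-< : ∀ {a b} → f a < f b → tiebreak f a < tiebreak f b
  tiebreak-< {a} {b} fa<fb = begin-strict
    f a * n + toℕ a   <⟨ +-monoʳ-< (f a * n) (toℕ<n a) ⟩
    f a * n + n       ≡⟨ +-comm (f a * n) n ⟩
    suc (f a) * n     ≤⟨ *-monoˡ-≤ n fa<fb ⟩
    f b * n           ≤⟨ m≤m+n (f b * n) (toℕ b) ⟩
    f b * n + toℕ b   ∎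
    where open ≤-Reasoning

  tiebreak-≤ : ∀ {a b} → tiebreak f a ≤ tiebreak f b → f a ≤ f b
  tiebreak-≤ ta≤tb = ≮⇒≥ (λ fb<fa → <⇒≱ (tiebreak-< fb<fa) ta≤tb)

  tiebreak-injective : Injective _≡_ _≡_ (tiebreak f)
  tiebreak-injective {a} {b} ta≡tb with <-cmp (f a) (f b)
  ... | tri< fa<fb _ _ = ⊥-elim (<-irrefl ta≡tb (tiebreak-< fa<fb))
  ... | tri> _ _ fb<fa = ⊥-elim (<-irrefl (≡.sym ta≡tb) (tiebreak-< fb<fa))
  ... | tri≈ _ fa≡fb _ = toℕ-injective (+-cancelˡ-≡ (f b * n) (toℕ a) (toℕ b)
                           (subst (λ x → x * n + toℕ a ≡ f b * n + toℕ b) fa≡fb ta≡tb))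

module _ {n : ℕ} (κ : Fin n → ℕ) where

  above : Fin n → ℕ
  above a = count (λ w → κ a <ᵇ κ w) (allFin n)

  nearTop : ℕ → List (Fin n)
  nearTop t = filterᵇ (λ a → above a ≤ᵇ t) (allFin n)

  length-nearTop : Injective _≡_ _≡_ κ → ∀ t → length (nearTop t) ≤ suc t
  length-nearTop κ-injective t with 0 <? length (nearTop t)
  ... | no empty = ≤-trans (≮⇒≥ empty) z≤n
  ... | yes nonempty with minimal-∈ κ (nearTop t) nonempty
  ...   | m , m∈ , minimal = begin
    length (nearTop t)                       ≡⟨ length-filterᵇ _ (allFin n) ⟩
    count (λ a → above a ≤ᵇ t) (allFin n)    ≤⟨ count-≤-suc _ (λ w → κ m <ᵇ κ w) m cover ⟩
    suc (above m)                            ≤⟨ s≤s (≤ᵇ⇒≤ _ _ (proj₂ (∈-filterᵇ⁻ (λ a → above a ≤ᵇ t) {xs = allFin n} m∈))) ⟩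
    suc t                                    ∎
    where
    open ≤-Reasoning
    cover : ∀ w → T (above w ≤ᵇ t) → m ≡ w ⊎ T (κ m <ᵇ κ w)
    cover w near with m ≟ w
    ... | yes m≡w = inj₁ m≡w
    ... | no m≢w = inj₂ (<⇒<ᵇ (≤∧≢⇒< (minimal (∈-filterᵇ⁺ (λ a → above a ≤ᵇ t) (∈-allFin w) near)) (m≢w ∘ κ-injective)))

above≤suc-codegree : ∀ {n} (G : SimpleGraph n) (κ : Fin n → ℕ) {v a : Fin n} →
  (∀ {w} → w ∈ nbrs G v → κ w ≤ κ a) → above κ a ≤ suc (deg (complement G) v)
above≤suc-codegree G κ {v} top =
  count≤suc-codegree G _ v (λ w a<w vw → <⇒≱ (<ᵇ⇒< _ _ a<w) (top (∈-filterᵇ⁺ (adj G v) (∈-allFin w) vw)))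

-- Gap labellings

module GapLabelling {n k : ℕ} {H : SimpleGraph n} {π c : Fin n → ℕ} (lab : IsGapLabelling H k π c) where

  π≤k : ∀ v → π v ≤ k
  π≤k v = proj₂ (proj₁ lab v)

  proper : ∀ u v → T (adj H u v) → c u ≢ c v
  proper = proj₁ (proj₂ (proj₂ lab))

  gap : ∀ v → 2 ≤ deg H v → c v ≡ maxL (map π (nbrs H v)) ∸ minL (map π (nbrs H v))
  gap = proj₁ (proj₂ (proj₂ (proj₂ lab)))

  -- Reversing π turns the minimum over a neighbourhood into a maximum, so a
  -- single rank argument bounds both ends of the gap.
  π⁻ : Fin n → ℕ
  π⁻ w = k ∸ π w

  κ⁺ κ⁻ : Fin n → ℕ
  κ⁺ = tiebreak π
  κ⁻ = tiebreak π⁻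

  κ⁻-≤ : ∀ {w b} → κ⁻ w ≤ κ⁻ b → π b ≤ π w
  κ⁻-≤ {w} {b} κ⁻w≤κ⁻b = ≮⇒≥ (λ πw<πb → <⇒≱ (tiebreak-< π⁻ (∸-monoʳ-< πw<πb (π≤k b))) κ⁻w≤κ⁻b)

  colour-of-extremes : ∀ {v a b} → 2 ≤ deg H v → a ∈ nbrs H v → b ∈ nbrs H v →
    (∀ {w} → w ∈ nbrs H v → κ⁺ w ≤ κ⁺ a) → (∀ {w} → w ∈ nbrs H v → κ⁻ w ≤ κ⁻ b) →
    c v ≡ π a ∸ π b
  colour-of-extremes {v} 2≤d a∈ b∈ a-top b-top = ≡.trans (gap v 2≤d)
    (cong₂ _∸_ (maxL-map-≡ π a∈ (tiebreak-≤ π ∘ a-top)) (minL-map-≡ π b∈ (κ⁻-≤ ∘ b-top)))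

  colour-class≤ : ∀ v → count (λ w → c w ≡ᵇ c v) (allFin n) ≤ suc (deg (complement H) v)
  colour-class≤ v = count≤suc-codegree H _ v (λ w cw≡cv vw → proper v w vw (≡.sym (≡ᵇ⇒≡ _ _ cw≡cv)))

  count-low≤ : ∀ D → 3 + D ≤ n →
    count (λ v → deg (complement H) v ≤ᵇ D) (allFin n) ≤ (2 + D) * (2 + D) * (1 + D)
  count-low≤ D 3+D≤n = begin
    count low (allFin n)                   ≡⟨ length-filterᵇ low (allFin n) ⟨
    length (filterᵇ low (allFin n))        ≤⟨ length≤-by-fibres c _ differences colour∈differences fibre ⟩
    length differences * (1 + D)           ≤⟨ *-monoˡ-≤ (1 + D) length-differences ⟩
    (2 + D) * (2 + D) * (1 + D)            ∎
    where
    open ≤-Reasoning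
    low : Fin n → Bool
    low v = deg (complement H) v ≤ᵇ D
    differences : List ℕ
    differences = cartesianProductWith (λ a b → π a ∸ π b) (nearTop κ⁺ (1 + D)) (nearTop κ⁻ (1 + D))
    length-differences : length differences ≤ (2 + D) * (2 + D)
    length-differences = ≤-trans (≤-reflexive (length-cartesianProductWith _ (nearTop κ⁺ (1 + D)) _))
      (*-mono-≤ (length-nearTop κ⁺ (tiebreak-injective π) (1 + D)) (length-nearTop κ⁻ (tiebreak-injective π⁻) (1 + D)))
    codegree≤D : ∀ {v} → v ∈ filterᵇ low (allFin n) → deg (complement H) v ≤ D
    codegree≤D v∈ = ≤ᵇ⇒≤ _ _ (proj₂ (∈-filterᵇ⁻ low {xs = allFin n} v∈))
    fibre : ∀ {v} → v ∈ filterᵇ low (allFin n) → count (λ w → c w ≡ᵇ c v) (filterᵇ low (allFin n)) ≤ 1 + D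
    fibre {v} v∈ = ≤-trans (count-filterᵇ-≤ _ low (allFin n)) (≤-trans (colour-class≤ v) (s≤s (codegree≤D v∈)))
    colour∈differences : ∀ {v} → v ∈ filterᵇ low (allFin n) → c v ∈ differences
    colour∈differences {v} v∈ =
      let (a , a∈ , a-top) = maximal-∈ κ⁺ (nbrs H v) 0<deg
          (b , b∈ , b-top) = maximal-∈ κ⁻ (nbrs H v) 0<deg
      in subst (_∈ differences) (≡.sym (colour-of-extremes 2≤d a∈ b∈ a-top b-top))
           (∈-cartesianProductWith⁺ _ (near-top κ⁺ a-top) (near-top κ⁻ b-top))
      where
      2≤d : 2 ≤ deg H v
      2≤d = 2≤deg H 3+D≤n (codegree≤D v∈)
      0<deg : 0 < deg H v
      0<deg = ≤-trans (s≤s z≤n) 2≤d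
      near-top : ∀ κ {a} → (∀ {w} → w ∈ nbrs H v → κ w ≤ κ a) → a ∈ nearTop κ (1 + D)
      near-top κ {a} top = ∈-filterᵇ⁺ (λ a → above κ a ≤ᵇ 1 + D) (∈-allFin a) (≤⇒≤ᵇ (≤-trans (above≤suc-codegree H κ top) (s≤s (codegree≤D v∈))))

  not-complete : 4 ≤ n → ¬ (∀ v → deg (complement H) v ≡ 0)
  not-complete 4≤n complete =
    let (a , _ , a-max) = maximal-∈ κ⁺ (allFin n) 0<n
        (b , _ , b-max) = maximal-∈ κ⁻ (allFin n) 0<n
    in <⇒≱ 4≤n (at-most-three a b a-max b-max)
    where
    0<n : 0 < length (allFin n)
    0<n = subst (0 <_) (≡.sym (length-tabulate id)) (≤-trans (s≤s z≤n) 4≤n)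
    covered : ∀ x y → 1 ≤ 𝟙 (not x ∧ not y) + (𝟙 x + 𝟙 y)
    covered true _ = s≤s z≤n
    covered false true = s≤s z≤n
    covered false false = s≤s z≤n
    at-most-three : ∀ a b → (∀ {w} → w ∈ allFin n → κ⁺ w ≤ κ⁺ a) → (∀ {w} → w ∈ allFin n → κ⁻ w ≤ κ⁻ b) → n ≤ 3
    at-most-three a b a-max b-max = begin
      n                                                        ≡⟨ ∑-allFin-1 n ⟨
      ∑[ v ∈ allFin n ] 1                                      ≤⟨ ∑-mono (allFin n) (λ {v} _ → covered (does (a ≟ v)) (does (b ≟ v))) ⟩
      ∑[ v ∈ allFin n ] (𝟙 (others v) + (𝟙 (does (a ≟ v)) + 𝟙 (does (b ≟ v))))
        ≡⟨ ≡.trans (∑-+ (allFin n) _ _) (cong (count others (allFin n) +_) (∑-+ (allFin n) _ _)) ⟩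
      count others (allFin n) + (count (λ v → does (a ≟ v)) (allFin n) + count (λ v → does (b ≟ v)) (allFin n))
        ≡⟨ cong₂ _+_ (≡.sym (length-filterᵇ others (allFin n))) (cong₂ _+_ (count-≟-allFin a) (count-≟-allFin b)) ⟩
      length (filterᵇ others (allFin n)) + 2                   ≤⟨ +-monoˡ-≤ 2 at-most-one-other ⟩
      3                                                        ∎
      where
      open ≤-Reasoning
      others : Fin n → Bool
      others v = not (does (a ≟ v)) ∧ not (does (b ≟ v))
      distinct : ∀ {v} → T (others v) → a ≢ v × b ≢ v
      distinct {v} other with a ≟ v | b ≟ v
      ... | no a≢v | no b≢v = a≢v , b≢v
      ... | yes _ | _ = ⊥-elim other
      ... | no _ | yes _ = ⊥-elim other
      neighbour : ∀ {v u} → u ≢ v → u ∈ nbrs H v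
      neighbour {v} {u} u≢v = ∈-filterᵇ⁺ (adj H v) (∈-allFin u) (codegree≡0⇒adjacent H (complete v) (u≢v ∘ ≡.sym))
      same-colour : ∀ {v} → v ∈ filterᵇ others (allFin n) → c v ∈ π a ∸ π b ∷ []
      same-colour {v} v∈ =
        let (a≢v , b≢v) = distinct (proj₂ (∈-filterᵇ⁻ others {xs = allFin n} v∈))
        in here (colour-of-extremes (2≤deg H (≤-trans (n≤1+n 3) 4≤n) (≤-reflexive (complete v)))
                  (neighbour a≢v) (neighbour b≢v) (λ {w} _ → a-max (∈-allFin w)) (λ {w} _ → b-max (∈-allFin w)))
      at-most-one-other : length (filterᵇ others (allFin n)) ≤ 1
      at-most-one-other = length≤-by-fibres c _ (π a ∸ π b ∷ []) same-colour
        (λ {v} _ → ≤-trans (count-filterᵇ-≤ _ others (allFin n)) (≤-trans (colour-class≤ v) (s≤s (≤-reflexive (complete v)))))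

-- Choosing the threshold

m≤m^3 : ∀ m → m ≤ m ^ 3
m≤m^3 zero = z≤n
m≤m^3 (suc m) = m≤m*n (suc m) (suc m ^ 2) {{m^n≢0 (suc m) 2}}

bracket : (f : ℕ → ℕ) {n : ℕ} → f 0 ≤ n → n < f n → ∃[ D ] f D ≤ n × n < f (suc D)
bracket f {n} f0≤n n<fn = search 0 n f0≤n n<fn
  where
  search : ∀ m k → f m ≤ n → n < f (m + k) → ∃[ D ] f D ≤ n × n < f (suc D)
  search m zero fm≤n n<f = ⊥-elim (<⇒≱ (subst (λ z → n < f z) (+-identityʳ m) n<f) fm≤n)
  search m (suc k) fm≤n n<f with f (suc m) ≤? n
  ... | yes fsm≤n = search (suc m) k fsm≤n (subst (λ z → n < f z) (+-suc m k) n<f)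
  ... | no fsm≰n = m , fm≤n , ≰⇒> fsm≰n

threshold : ℕ → ℕ
threshold D = 2 * (2 + D) ^ 3

3+D≤threshold : ∀ D → 3 + D ≤ threshold D
3+D≤threshold D = ≤-trans (≤-trans (m≤m+n (3 + D) (1 + D)) (≤-reflexive (double D))) (*-monoʳ-≤ 2 (m≤m^3 (2 + D)))
  where
  double : ∀ D → 3 + D + (1 + D) ≡ 2 * (2 + D)
  double = solve-∀

≤-double-of-rest : ∀ {n lo hi} → lo + lo ≤ n → n ≤ lo + hi → n ≤ hi + hi
≤-double-of-rest {n} {lo} {hi} lo+lo≤n n≤lo+hi = +-cancelˡ-≤ n n (hi + hi) (begin
  n + n                    ≤⟨ +-mono-≤ n≤lo+hi n≤lo+hi ⟩
  (lo + hi) + (lo + hi)    ≡⟨ interchange lo hi lo hi ⟩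
  (lo + lo) + (hi + hi)    ≤⟨ +-monoˡ-≤ (hi + hi) lo+lo≤n ⟩
  n + (hi + hi)            ∎)
  where open ≤-Reasoning

sixth-power-bound : ∀ {n s} E .{{_ : NonZero E}} → n ≤ 54 * E ^ 3 → n * E ≤ 4 * s → n ^ 6 ≤ 55296 * s ^ 5
sixth-power-bound {n} {s} E n≤54E³ nE≤4s = begin
  n ^ 6                                ≡⟨ split n ⟩
  n * n ^ 3 * n ^ 2                    ≤⟨ *-mono-≤ (*-monoˡ-≤ (n ^ 3) n≤54E³) (^-monoˡ-≤ 2 n≤4s) ⟩
  54 * E ^ 3 * n ^ 3 * (4 * s) ^ 2     ≡⟨ cong (_* (4 * s) ^ 2) (regroup E n) ⟩
  54 * (n * E) ^ 3 * (4 * s) ^ 2       ≤⟨ *-monoˡ-≤ ((4 * s) ^ 2) (*-monoʳ-≤ 54 (^-monoˡ-≤ 3 nE≤4s)) ⟩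
  54 * (4 * s) ^ 3 * (4 * s) ^ 2       ≡⟨ collect s ⟩
  55296 * s ^ 5                        ∎
  where
  open ≤-Reasoning
  n≤4s : n ≤ 4 * s
  n≤4s = ≤-trans (m≤m*n n E) nE≤4s
  split : ∀ n → n * (n * (n * (n * (n * (n * 1))))) ≡ n * (n * (n * (n * 1))) * (n * (n * 1))
  split = solve-∀
  regroup : ∀ E n → 54 * (E * (E * (E * 1))) * (n * (n * (n * 1))) ≡ 54 * ((n * E) * ((n * E) * ((n * E) * 1)))
  regroup = solve-∀
  collect : ∀ s → 54 * (4 * s * (4 * s * (4 * s * 1))) * (4 * s * (4 * s * 1)) ≡ 55296 * (s * (s * (s * (s * (s * 1)))))
  collect = solve-∀

bound-from-counts : ∀ {n s lo hi} D → threshold D ≤ n → n < threshold (suc D) →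
  n ≤ lo + hi → lo ≤ (2 + D) * (2 + D) * (1 + D) → hi * (1 + D) ≤ s + s → n ^ 6 ≤ 55296 * s ^ 5
bound-from-counts {n} {s} {lo} {hi} D lower upper n≤lo+hi lo≤ hi≤ = sixth-power-bound {s = s} (1 + D) n≤54E³ nE≤4s
  where
  open ≤-Reasoning
  lo≤cube : lo ≤ (2 + D) ^ 3
  lo≤cube = ≤-trans lo≤ (≤-trans (*-monoʳ-≤ ((2 + D) * (2 + D)) (n≤1+n (1 + D))) (≤-reflexive (cube (2 + D))))
    where
    cube : ∀ x → x * x * x ≡ x * (x * (x * 1))
    cube = solve-∀
  n≤hi+hi : n ≤ hi + hi
  n≤hi+hi = ≤-double-of-rest {lo = lo} {hi} (≤-trans (+-mono-≤ lo≤cube lo≤cube) (≤-trans (≤-reflexive (twice ((2 + D) ^ 3))) lower)) n≤lo+hi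
    where
    twice : ∀ x → x + x ≡ 2 * x
    twice = solve-∀
  nE≤4s : n * (1 + D) ≤ 4 * s
  nE≤4s = begin
    n * (1 + D)                        ≤⟨ *-monoˡ-≤ (1 + D) n≤hi+hi ⟩
    (hi + hi) * (1 + D)                ≡⟨ *-distribʳ-+ (1 + D) hi hi ⟩
    hi * (1 + D) + hi * (1 + D)        ≤⟨ +-mono-≤ hi≤ hi≤ ⟩
    s + s + (s + s)                    ≡⟨ four s ⟩
    4 * s                              ∎
    where
    four : ∀ s → s + s + (s + s) ≡ 4 * s
    four = solve-∀
  n≤54E³ : n ≤ 54 * (1 + D) ^ 3
  n≤54E³ = begin
    n                            ≤⟨ <⇒≤ upper ⟩
    2 * (3 + D) ^ 3              ≤⟨ *-monoʳ-≤ 2 (^-monoˡ-≤ 3 (≤-trans (m≤m+n (3 + D) (2 * D)) (≤-reflexive (triple D)))) ⟩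
    2 * (3 * (1 + D)) ^ 3        ≡⟨ expand D ⟩
    54 * (1 + D) ^ 3             ∎
    where
    triple : ∀ D → 3 + D + 2 * D ≡ 3 * (1 + D)
    triple = solve-∀
    expand : ∀ D → 2 * (3 * (1 + D) * (3 * (1 + D) * (3 * (1 + D) * 1))) ≡ 54 * ((1 + D) * ((1 + D) * ((1 + D) * 1)))
    expand = solve-∀

module _ {n s : ℕ} {H : SimpleGraph n} (removes : Removes (K n) s H)
         {k : ℕ} {π c : Fin n → ℕ} (lab : IsGapLabelling H k π c) where

  open GapLabelling {n} {k} {H} {π} {c} lab

  0<s : 4 ≤ n → 0 < s
  0<s 4≤n with 0 <? s
  ... | yes 0<s = 0<s
  ... | no s≯0 = ⊥-elim (not-complete 4≤n complete)
    where
    s≡0 : s ≡ 0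
    s≡0 = n≤0⇒n≡0 (≮⇒≥ s≯0)
    complete : ∀ v → deg (complement H) v ≡ 0
    complete v = ∑≡0⇒≡0 (allFin n) _ (≡.trans (∑-deg-complement H removes) (cong₂ _+_ s≡0 s≡0)) (∈-allFin v)

  bound-at-threshold : ∀ D → threshold D ≤ n → n < threshold (suc D) → n ^ 6 ≤ 55296 * s ^ 5
  bound-at-threshold D lower upper =
    bound-from-counts {s = s} D lower upper n≤low+high (count-low≤ D (≤-trans (3+D≤threshold D) lower)) high≤
    where
    low : Fin n → Bool
    low v = deg (complement H) v ≤ᵇ D
    n≤low+high : n ≤ count low (allFin n) + count (not ∘ low) (allFin n)
    n≤low+high = ≤-reflexive (≡.trans (≡.sym (length-tabulate id)) (length≡count+count-not low (allFin n)))
    high≤ : count (not ∘ low) (allFin n) * (1 + D) ≤ s + s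
    high≤ = ≤-trans (markov (deg (complement H)) D (allFin n)) (≤-reflexive (∑-deg-complement H removes))

  removal-bound : 4 ≤ n → n ^ 6 ≤ 55296 * 16 ^ 6 * s ^ 5
  removal-bound 4≤n = by-size (threshold 0 ≤? n)
    where
    open ≤-Reasoning
    -- A with-abstraction here would normalise the goal and unfold the literal
    -- 55296 * 16 ^ 6 against the open term s ^ 5.
    by-size : Dec (threshold 0 ≤ n) → n ^ 6 ≤ 55296 * 16 ^ 6 * s ^ 5
    by-size (yes 16≤n) =
      let (D , lower , upper) = bracket threshold 16≤n (≤-trans (m<n+m n (s≤s z≤n)) (3+D≤threshold n))
      in ≤-trans (bound-at-threshold D lower upper) (*-monoˡ-≤ (s ^ 5) (m≤m*n 55296 (16 ^ 6)))
    by-size (no n≱16) = begin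
      n ^ 6                      ≤⟨ ^-monoˡ-≤ 6 (<⇒≤ (≰⇒> n≱16)) ⟩
      16 ^ 6                     ≤⟨ m≤n*m (16 ^ 6) 55296 ⟩
      55296 * 16 ^ 6             ≡⟨ *-identityʳ (55296 * 16 ^ 6) ⟨
      55296 * 16 ^ 6 * 1 ^ 5     ≤⟨ *-monoʳ-≤ (55296 * 16 ^ 6) (^-monoˡ-≤ 5 (0<s 4≤n)) ⟩
      55296 * 16 ^ 6 * s ^ 5     ∎

theorem8 : Σ ℕ λ a → Σ ℕ λ b → (1 ≤ a) × (1 ≤ b) ×
    ((n : ℕ) → 4 ≤ n → (s : ℕ) → IsGapStrength (K n) s → a * n ^ 6 ≤ b * s ^ 5)
theorem8 = 1 , 55296 * 16 ^ 6 , ≤-refl , s≤s z≤n , bound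
  where
  bound : (n : ℕ) → 4 ≤ n → (s : ℕ) → IsGapStrength (K n) s → 1 * n ^ 6 ≤ 55296 * 16 ^ 6 * s ^ 5
  bound n 4≤n s ((H , removes , k , π , c , lab) , _) =
    ≤-trans (≤-reflexive (*-identityˡ (n ^ 6))) (removal-bound {n} {s} {H} removes {k} {π} {c} lab 4≤n)
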